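{- Let $G=(V,E)$ be a graph satisfying the standing assumptions. Let $u\in V$ and let $(u_i)_{i\ge1}$ be an occurrence of $\min_u$ starting at $u$. Let $k\ge1$ be such that $\tau(u_1)=\tau(u_2)=\dots=\tau(u_k)\neq2$. Then $u_1,\dots,u_k$ are pairwise distinct; in particular $k\le|V|$.
   Context: Standing assumptions: $\Sigma$ is a finite alphabet with a total order $\preceq$; $G=(V,E)$ is finite, $E\subseteq V\times V\times\Sigma$, every node has an incoming edge, all edges entering a node $u$ have the same label $\lambda(u)$ (edges are written $(u,v)$), and $G$ is deterministic. An occurrence of $\alpha\in\Sigma^\omega$ starting at $u$ is a sequence $(u_i)_{i\ge1}$ with $u_1=u$, $(u_{i+1},u_i)\in E$, $\lambda(u_i)=\alpha[i]$; $\min_u$ is the lexicographically smallest string in $\Sigma^\omega$ with an occurrence starting at $u$. For $\alpha=a\alpha'$ ($a\in\Sigma$): $\tau(\alpha)=1$ if $\alpha'\prec\alpha$, $2$ if $\alpha'=\alpha$, $3$ if $\alpha\prec\alpha'$; $\tau(u):=\tau(\min_u)$. -}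

module Defs where

open import Data.Nat using (ℕ; zero; suc; _<_)
open import Data.Fin using (Fin) renaming (_<_ to _<ᶠ_)
open import Data.Product using (Σ; ∃; _×_)
open import Data.Sum using (_⊎_)
open import Relation.Binary.PropositionalEquality using (_≡_)
open import Relation.Nullary using (¬_)

-- Alphabet: Fin σ with its standard total order (any finite total order is
-- isomorphic to one of these).  Nodes: Fin n.

-- Infinite strings over Fin σ, indexed from 0 (α 0 is the paper's α[1]).
Str : ℕ → Set
Str σ = ℕ → Fin σ

tail : ∀ {σ} → Str σ → Str σ
tail α i = α (suc i)

_≐_ : ∀ {σ} → Str σ → Str σ → Set
α ≐ β = ∀ i → α i ≡ β i

_≺_ : ∀ {σ} → Str σ → Str σ → Set
α ≺ β = ∃ λ n → (∀ i → i < n → α i ≡ β i) × (α n <ᶠ β n)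

_⪯_ : ∀ {σ} → Str σ → Str σ → Set
α ⪯ β = α ≺ β ⊎ α ≐ β

-- A labelled graph satisfying the standing assumptions.
-- E u v means there is an edge (u,v); its label is λ v (all edges entering v
-- carry the same label λ v).
record Graph (n σ : ℕ) : Set₁ where
  field
    E   : Fin n → Fin n → Set
    lab : Fin n → Fin σ
    incoming : ∀ v → ∃ λ u → E u v
    deterministic : ∀ {u v w} → E u v → E u w → lab v ≡ lab w → v ≡ w

module _ {n σ : ℕ} (G : Graph n σ) where
  open Graph G

  -- (us i)_{i ≥ 0} is an occurrence of α starting at u
  -- (us 0 is the paper's u_1)
  Occurrence : Str σ → Fin n → (ℕ → Fin n) → Set
  Occurrence α u us =
    (us 0 ≡ u) × (∀ i → E (us (suc i)) (us i)) × (∀ i → lab (us i) ≡ α i)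

  HasOcc : Str σ → Fin n → Set
  HasOcc α u = ∃ λ us → Occurrence α u us

  IsMin : Fin n → Str σ → Set
  IsMin u α = HasOcc α u × (∀ β → HasOcc β u → α ⪯ β)

data TauVal : Set where
  τ1 τ2 τ3 : TauVal

HasTauStr : ∀ {σ} → Str σ → TauVal → Set
HasTauStr α τ1 = tail α ≺ α
HasTauStr α τ2 = tail α ≐ α
HasTauStr α τ3 = α ≺ tail α

HasTau : ∀ {n σ} → Graph n σ → Fin n → TauVal → Set
HasTau G u t = ∃ λ α → IsMin G u α × HasTauStr α t

{-# OPTIONS --safe #-}
module Submission where

-- Every suffix of min_u along its own occurrence is again minimal:
-- min_{u_{i+1}} is the tail of min_{u_i}, so min_{u_i} is the i-th suffix of
-- α = min_u.  A constant value τ1 (resp. τ3) makes these suffixes strictly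
-- decreasing (resp. increasing) lexicographically, hence pairwise different;
-- since min_v depends only on v, the nodes u_i must be pairwise different too,
-- and the pigeonhole principle bounds k by |V|.

open import Defs
open import Data.Nat using (ℕ; zero; suc; _<_; _≤_; s≤s; _≤?_)
open import Data.Nat.Properties using (<-cmp; ≰⇒>; <-trans; n<1+n; m≤n⇒m<n∨m≡n)
open import Data.Fin using (Fin; toℕ) renaming (_<_ to _<ᶠ_)
import Data.Fin.Properties as Fin
open import Data.Product using (_×_; _,_)
open import Data.Sum using (_⊎_; inj₁; inj₂)
open import Data.Empty using (⊥-elim)
open import Function using (flip; _∘_)
open import Relation.Nullary using (¬_; yes; no)
open import Relation.Binary.Core using (Rel)
open import Relation.Binary.Definitions
  using (Transitive; Irreflexive; tri<; tri≈; tri>)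
open import Relation.Binary.PropositionalEquality
  using (_≡_; _≢_; refl; sym; trans; subst)

chain : ∀ {a ℓ} {A : Set a} {R : Rel A ℓ} → Transitive R → (f : ℕ → A) → ∀ {k}
      → (∀ {m} → suc m < k → R (f m) (f (suc m)))
      → ∀ {i j} → i < j → j < k → R (f i) (f j)
chain {R = R} tr f step {j = suc j} (s≤s i≤j) sj<k with m≤n⇒m<n∨m≡n i≤j
... | inj₂ refl = step sj<k
... | inj₁ i<j  = tr (chain {R = R} tr f step i<j (<-trans (n<1+n j) sj<k)) (step sj<k)

module _ {A : Set} {f : ℕ → A} {k : ℕ}
         (noRepeat : ∀ {i j} → i < j → j < k → f i ≢ f j) where

  pairwise-≢ : ∀ i j → i < k → j < k → i ≢ j → f i ≢ f j
  pairwise-≢ i j i<k j<k i≢j with <-cmp i j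
  ... | tri< i<j _ _ = noRepeat i<j j<k
  ... | tri≈ _ i≡j _ = ⊥-elim (i≢j i≡j)
  ... | tri> _ _ j<i = noRepeat j<i i<k ∘ sym

noRepeat⇒≤ : ∀ {n k} (f : ℕ → Fin n)
           → (∀ {i j} → i < j → j < k → f i ≢ f j) → k ≤ n
noRepeat⇒≤ {n} {k} f noRepeat with k ≤? n
... | yes k≤n = k≤n
... | no k≰n with Fin.pigeonhole (≰⇒> k≰n) (f ∘ toℕ)
...   | i , j , i<j , fi≡fj = ⊥-elim (noRepeat i<j (Fin.toℕ<n j) fi≡fj)

_∷_ : ∀ {σ} → Fin σ → Str σ → Str σ
(a ∷ α) zero    = a
(a ∷ α) (suc i) = α i

drop : ∀ {σ} → ℕ → Str σ → Str σ
drop zero    α = α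
drop (suc i) α = drop i (tail α)

tail-drop : ∀ {σ} i (α : Str σ) → tail (drop i α) ≐ drop (suc i) α
tail-drop zero    α j = refl
tail-drop (suc i) α j = tail-drop i (tail α) j

module _ {σ : ℕ} where

  ≐-sym : {α β : Str σ} → α ≐ β → β ≐ α
  ≐-sym e i = sym (e i)

  ≐-trans : {α β γ : Str σ} → α ≐ β → β ≐ γ → α ≐ γ
  ≐-trans e e′ i = trans (e i) (e′ i)

  ≺-respˡ-≐ : {α α′ β : Str σ} → α ≐ α′ → α ≺ β → α′ ≺ β
  ≺-respˡ-≐ e (N , agree , lt) =
    N , (λ i i<N → trans (sym (e i)) (agree i i<N)) , subst (_<ᶠ _) (e N) lt

  ≺-respʳ-≐ : {α β β′ : Str σ} → β ≐ β′ → α ≺ β → α ≺ β′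
  ≺-respʳ-≐ e (N , agree , lt) =
    N , (λ i i<N → trans (agree i i<N) (e i)) , subst (_ <ᶠ_) (e N) lt

  ≺-irrefl : Irreflexive _≐_ (_≺_ {σ})
  ≺-irrefl e (N , _ , lt) = Fin.<-irrefl (e N) lt

  ≺-trans : Transitive (_≺_ {σ})
  ≺-trans {α} {β} {γ} (m , agree₁ , lt₁) (n , agree₂ , lt₂) with <-cmp m n
  ... | tri< m<n _ _ =
    m , (λ i i<m → trans (agree₁ i i<m) (agree₂ i (<-trans i<m m<n)))
      , subst (α m <ᶠ_) (agree₂ m m<n) lt₁
  ... | tri≈ _ refl _ =
    m , (λ i i<m → trans (agree₁ i i<m) (agree₂ i i<m)) , Fin.<-trans lt₁ lt₂
  ... | tri> _ _ n<m =
    n , (λ i i<n → trans (agree₁ i (<-trans i<n n<m)) (agree₂ i i<n))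
      , subst (_<ᶠ γ n) (sym (agree₁ n n<m)) lt₂

  ⪯-antisym : {α β : Str σ} → α ⪯ β → β ⪯ α → α ≐ β
  ⪯-antisym (inj₂ e) _        = e
  ⪯-antisym (inj₁ p) (inj₁ q) = ⊥-elim (≺-irrefl (λ _ → refl) (≺-trans p q))
  ⪯-antisym (inj₁ p) (inj₂ e) = ⊥-elim (≺-irrefl (≐-sym e) p)

  ⪯-tail : {α β : Str σ} → α 0 ≡ β 0 → α ⪯ β → tail α ⪯ tail β
  ⪯-tail _     (inj₂ e)                    = inj₂ (e ∘ suc)
  ⪯-tail α₀≡β₀ (inj₁ (zero , _ , lt))      = ⊥-elim (Fin.<-irrefl α₀≡β₀ lt)
  ⪯-tail _     (inj₁ (suc N , agree , lt)) = inj₁ (N , (λ i → agree (suc i) ∘ s≤s) , lt)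

  HasTauStr-resp-≐ : ∀ {α β : Str σ} t → α ≐ β → HasTauStr α t → HasTauStr β t
  HasTauStr-resp-≐ τ1 e h = ≺-respʳ-≐ e (≺-respˡ-≐ (e ∘ suc) h)
  HasTauStr-resp-≐ τ2 e h = ≐-trans (≐-sym (e ∘ suc)) (≐-trans h e)
  HasTauStr-resp-≐ τ3 e h = ≺-respʳ-≐ (e ∘ suc) (≺-respˡ-≐ e h)

  drops-distinct : ∀ {α : Str σ} {k} t → t ≢ τ2
                 → (∀ {m} → m < k → HasTauStr (drop m α) t)
                 → ∀ {i j} → i < j → j < k → ¬ (drop i α ≐ drop j α)
  drops-distinct {α} {k} τ1 _ τ i<j j<k e =
    ≺-irrefl (≐-sym e) (chain {R = flip _≺_} (flip ≺-trans) (λ m → drop m α) step i<j j<k)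
    where
    step : ∀ {m} → suc m < k → drop (suc m) α ≺ drop m α
    step {m} sm<k = ≺-respˡ-≐ (tail-drop m α) (τ (<-trans (n<1+n m) sm<k))
  drops-distinct τ2 τ2≢τ2 = ⊥-elim (τ2≢τ2 refl)
  drops-distinct {α} {k} τ3 _ τ i<j j<k e =
    ≺-irrefl e (chain {R = _≺_} ≺-trans (λ m → drop m α) step i<j j<k)
    where
    step : ∀ {m} → suc m < k → drop m α ≺ drop (suc m) α
    step {m} sm<k = ≺-respʳ-≐ (tail-drop m α) (τ (<-trans (n<1+n m) sm<k))

module _ {n σ : ℕ} (G : Graph n σ) where
  open Graph G

  Occurrence-tail : ∀ {α u us} → Occurrence G α u us
                  → Occurrence G (tail α) (us 1) (tail us)
  Occurrence-tail (_ , edge , label) = refl , edge ∘ suc , label ∘ suc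

  Occurrence-∷ : ∀ {β u v vs} → E v u → Occurrence G β v vs
               → Occurrence G (lab u ∷ β) u (u ∷ vs)
  Occurrence-∷ {β} {u} {vs = vs} e (refl , edge , label) = refl , edges , labels
    where
    edges : ∀ i → E ((u ∷ vs) (suc i)) ((u ∷ vs) i)
    edges zero    = e
    edges (suc i) = edge i
    labels : ∀ i → lab ((u ∷ vs) i) ≡ (lab u ∷ β) i
    labels zero    = refl
    labels (suc i) = label i

  IsMin-unique : ∀ {u α β} → IsMin G u α → IsMin G u β → α ≐ β
  IsMin-unique (occα , minα) (occβ , minβ) = ⪯-antisym (minα _ occβ) (minβ _ occα)

  HasTau-IsMin : ∀ {u α t} → HasTau G u t → IsMin G u α → HasTauStr α t
  HasTau-IsMin {t = t} (β , minβ , τβ) minα =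
    HasTauStr-resp-≐ t (IsMin-unique minβ minα) τβ

  IsMin-tail : ∀ {u α us} → IsMin G u α → Occurrence G α u us
             → IsMin G (us 1) (tail α)
  IsMin-tail {α = α} {us} (_ , minα) occ@(refl , edge , label) =
    (tail us , Occurrence-tail occ) , minTail
    where
    minTail : ∀ β → HasOcc G β (us 1) → tail α ⪯ β
    minTail β (vs , occβ) =
      ⪯-tail (sym (label 0)) (minα _ (us 0 ∷ vs , Occurrence-∷ (edge 0) occβ))

  IsMin-drop : ∀ {α us} → IsMin G (us 0) α → Occurrence G α (us 0) us
             → ∀ i → IsMin G (us i) (drop i α)
  IsMin-drop minα occ zero    = minα
  IsMin-drop minα occ (suc i) =
    IsMin-drop (IsMin-tail minα occ) (Occurrence-tail occ) i

lemma13 : ∀ {n σ} (G : Graph n σ) (u : Fin n) (α : Defs.Str σ) (us : ℕ → Fin n)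
          → IsMin G u α → Occurrence G α u us
          → (k : ℕ) → 1 ≤ k
          → (t : TauVal) → t ≢ τ2 → (∀ i → i < k → HasTau G (us i) t)
          → (∀ i j → i < k → j < k → i ≢ j → us i ≢ us j) × (k ≤ n)
lemma13 G u α us minα occ@(refl , _) k _ t t≢τ2 τ-us =
  pairwise-≢ noRepeat , noRepeat⇒≤ us noRepeat
  where
  isMin : ∀ i → IsMin G (us i) (drop i α)
  isMin = IsMin-drop G minα occ

  noRepeat : ∀ {i j} → i < j → j < k → us i ≢ us j
  noRepeat {i} {j} i<j j<k us-i≡us-j =
    drops-distinct t t≢τ2 (λ {m} m<k → HasTau-IsMin G (τ-us m m<k) (isMin m)) i<j j<k
      (IsMin-unique G (isMin i) (subst (λ v → IsMin G v (drop j α)) (sym us-i≡us-j) (isMin j)))
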